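{- Let $M$ be a matroid of rank $d$ on $[n]$, $I\subseteq[n]$ such that no element of $I$ is a loop of $M$, and $w\in\mathbb{R}^n$ with pairwise distinct coordinates. Then $\Delta_w(M,I)$ is a pure simplicial complex of dimension $d-1$.
   Context: $w$ orders $[n]$ by $i<j$ iff $w_i<w_j$. For a circuit $C$ of $M$, $b_I(C)=C\setminus\min(C)$ if $C\subseteq I$, and $b_I(C)=(C\cap I)\cup\{\max(C\setminus I)\}$ otherwise. $\Delta_w(M,I)$ is the simplicial complex of all $\tau\subseteq[n]$ containing no $b_I(C)$ for $C$ a circuit of $M$. Pure of dimension $d-1$ means every facet (maximal face) has exactly $d$ elements.
   Formalization: The vector w is taken in ℚ^n, with pairwise distinct coordinates, rather than in ℝ^n. -}

module Defs where

open import Data.Nat using (ℕ; _≤_)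
open import Data.Fin using (Fin)
open import Data.Fin.Subset using (Subset; _∈_; _∉_; _⊆_; _⊈_; _∩_; _∪_; _─_; _-_; ⁅_⁆; ∣_∣; Empty)
open import Data.Rational using (ℚ) renaming (_<_ to _<ℚ_)
open import Data.Product using (Σ; _×_; ∃)
open import Data.Sum using (_⊎_)
open import Relation.Nullary using (¬_)
open import Relation.Binary.PropositionalEquality using (_≡_; _≢_)
open import Function.Definitions using (Injective)

record Matroid (n : ℕ) : Set₁ where
  field
    IsCircuit : Subset n → Set
    circuit-nonempty : ∀ C → IsCircuit C → ¬ Empty C
    circuit-incomparable : ∀ C₁ C₂ → IsCircuit C₁ → IsCircuit C₂ → C₁ ⊆ C₂ → C₁ ≡ C₂
    circuit-elim : ∀ C₁ C₂ e → IsCircuit C₁ → IsCircuit C₂ → C₁ ≢ C₂ →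
                   e ∈ C₁ → e ∈ C₂ →
                   ∃ λ C₃ → IsCircuit C₃ × C₃ ⊆ ((C₁ ∪ C₂) - e)

module _ {n : ℕ} (M : Matroid n) where
  open Matroid M

  Independent : Subset n → Set
  Independent A = ∀ C → IsCircuit C → C ⊈ A

  HasRank : ℕ → Set
  HasRank d = (∃ λ B → Independent B × ∣ B ∣ ≡ d)
            × (∀ A → Independent A → ∣ A ∣ ≤ d)

  IsLoop : Fin n → Set
  IsLoop e = IsCircuit ⁅ e ⁆

module _ {n : ℕ} (w : Fin n → ℚ) where
  _<w_ : Fin n → Fin n → Set
  i <w j = w i <ℚ w j

  IsMinW : Subset n → Fin n → Set
  IsMinW A m = m ∈ A × (∀ x → x ∈ A → x ≢ m → m <w x)

  IsMaxW : Subset n → Fin n → Set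
  IsMaxW A m = m ∈ A × (∀ x → x ∈ A → x ≢ m → x <w m)

  IsB : Subset n → Subset n → Subset n → Set
  IsB I C B =
      (C ⊆ I × (∃ λ m → IsMinW C m × B ≡ C - m))
    ⊎ (C ⊈ I × (∃ λ m → IsMaxW (C ─ I) m × B ≡ (C ∩ I) ∪ ⁅ m ⁆))

module _ {n : ℕ} (w : Fin n → ℚ) (M : Matroid n) (I : Subset n) where
  open Matroid M

  IsFace : Subset n → Set
  IsFace τ = ∀ C B → IsCircuit C → IsB w I C B → B ⊈ τ

  IsFacet : Subset n → Set
  IsFacet τ = IsFace τ × (∀ σ → IsFace σ → τ ⊆ σ → σ ≡ τ)

  PureOfDim-1 : ℕ → Set
  PureOfDim-1 d = ∀ τ → IsFacet τ → ∣ τ ∣ ≡ d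

-- A face of Δ_w(M,I) is independent, since b_I(C) ⊆ C for every circuit C. Order [n] by
-- putting the elements outside I first and then comparing w; every element of C ∖ b_I(C)
-- precedes every element of b_I(C). For a facet τ, induction along this order shows that τ
-- spans every x: otherwise τ ∪ {x} is independent and, τ being a facet, contains some b_I(C)
-- with x ∈ b_I(C); the other elements of C lie in τ or precede x, so they are spanned by τ,
-- and then so is x. Hence facets are bases, and all bases of M have d elements.

module Submission where

open import Defs
open import Data.Nat using (ℕ; _≤_; _≤?_; _+_; suc; z≤n; s≤s)
open import Data.Nat.Properties as ℕ using (≤-trans; ≤-antisym)
open import Data.Fin using (Fin)
open import Data.Fin.Properties using (any?) renaming (_≟_ to _≟ᶠ_)
open import Data.Fin.Induction using (spo-wellFounded)
open import Data.Fin.Subset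
open import Data.Fin.Subset.Properties
open import Data.Fin.Subset.Induction using (⊂-wellFounded)
open import Data.Vec.Base using ([]; _∷_; here; there)
open import Data.Product using (∃; _×_; _,_; proj₁; proj₂)
open import Data.Sum as Sum using (_⊎_; inj₁; inj₂; [_,_])
open import Data.Empty using (⊥-elim)
open import Induction.WellFounded using (Acc; acc; module All)
open import Data.Rational using (ℚ)
import Data.Rational.Properties as ℚ
open import Function using (_∘_; case_of_)
open import Function.Definitions using (Injective)
open import Relation.Binary using (Rel; IsStrictTotalOrder; IsStrictPartialOrder; Trichotomous; tri<; tri≈; tri>)
import Relation.Binary.Construct.Flip.EqAndOrd as Flip
open import Relation.Nullary using (¬_; yes; no; contradiction)
open import Relation.Nullary.Decidable using (_×-dec_; decidable-stable)
open import Relation.Unary using (Pred; Decidable)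
open import Relation.Binary.PropositionalEquality using (_≡_; _≢_; refl; sym; cong; subst; isEquivalence; resp₂)

private
  variable
    n : ℕ
    p q r : Subset n
    x y : Fin n

x∈p─q⇒x∉q : x ∈ p ─ q → x ∉ q
x∈p─q⇒x∉q {p = inside ∷ p} {outside ∷ q} here = λ ()
x∈p─q⇒x∉q {p = s ∷ p} {t ∷ q} (there x∈p─q) (there x∈q) = x∈p─q⇒x∉q x∈p─q x∈q

x∈p-y⇒x≢y : x ∈ p - y → x ≢ y
x∈p-y⇒x≢y x∈p-y = x∉⁅y⁆⇒x≢y (x∈p─q⇒x∉q x∈p-y)

x∈p∪⁅y⁆⁻ : x ∈ p ∪ ⁅ y ⁆ → x ∈ p ⊎ x ≡ y
x∈p∪⁅y⁆⁻ {p = p} {y = y} x∈ = Sum.map₂ (x∈⁅y⁆⇒x≡y y) (x∈p∪q⁻ p ⁅ y ⁆ x∈)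

x∈p∪⁅y⁆∧x≢y⇒x∈p : x ∈ p ∪ ⁅ y ⁆ → x ≢ y → x ∈ p
x∈p∪⁅y⁆∧x≢y⇒x∈p x∈ x≢y with x∈p∪⁅y⁆⁻ x∈
... | inj₁ x∈p = x∈p
... | inj₂ x≡y = contradiction x≡y x≢y

p⊈q⇒∃ : ¬ p ⊆ q → ∃ λ x → x ∈ p × x ∉ q
p⊈q⇒∃ {p = p} {q} p⊈q with nonempty? (p ─ q)
... | yes (x , x∈p─q) = x , p─q⊆p p q x∈p─q , x∈p─q⇒x∉q x∈p─q
... | no p─q-empty = ⊥-elim (p⊈q p⊆q)
  where
  p⊆q : p ⊆ q
  p⊆q {x} x∈p with x ∈? q
  ... | yes x∈q = x∈q
  ... | no x∉q = contradiction (x , x∈p∧x∉q⇒x∈p─q x∈p x∉q) p─q-empty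

∪-⊆ : p ⊆ r → q ⊆ r → p ∪ q ⊆ r
∪-⊆ {p = p} {q = q} p⊆r q⊆r x∈p∪q = [ p⊆r , q⊆r ] (x∈p∪q⁻ p q x∈p∪q)

x∉p∪q : x ∉ p → x ∉ q → x ∉ p ∪ q
x∉p∪q {p = p} {q = q} x∉p x∉q x∈p∪q = [ x∉p , x∉q ] (x∈p∪q⁻ p q x∈p∪q)

x∈p∪q∧x∉p⇒x∈q : x ∈ p ∪ q → x ∉ p → x ∈ q
x∈p∪q∧x∉p⇒x∈q {p = p} {q = q} x∈p∪q x∉p with x∈p∪q⁻ p q x∈p∪q
... | inj₁ x∈p = contradiction x∈p x∉p
... | inj₂ x∈q = x∈q

p⊆q∪⁅x⁆∧x∉p⇒p⊆q : p ⊆ q ∪ ⁅ x ⁆ → x ∉ p → p ⊆ q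
p⊆q∪⁅x⁆∧x∉p⇒p⊆q p⊆q∪⁅x⁆ x∉p y∈p = x∈p∪⁅y⁆∧x≢y⇒x∈p (p⊆q∪⁅x⁆ y∈p) λ { refl → x∉p y∈p }

p-x⊆p : p - x ⊆ p
p-x⊆p {p = p} {x = x} = p─q⊆p p ⁅ x ⁆

-‿monoˡ : p ⊆ q → p - x ⊆ q - x
-‿monoˡ p⊆q y∈p-x = x∈p∧x≢y⇒x∈p-y (p⊆q (p-x⊆p y∈p-x)) (x∈p-y⇒x≢y y∈p-x)

∣p∪q∣≤∣p∣+∣q∣ : ∀ (p q : Subset n) → ∣ p ∪ q ∣ ≤ ∣ p ∣ + ∣ q ∣
∣p∪q∣≤∣p∣+∣q∣ []            []            = z≤n
∣p∪q∣≤∣p∣+∣q∣ (outside ∷ p) (outside ∷ q) = ∣p∪q∣≤∣p∣+∣q∣ p q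
∣p∪q∣≤∣p∣+∣q∣ (outside ∷ p) (inside  ∷ q) = ≤-trans (s≤s (∣p∪q∣≤∣p∣+∣q∣ p q)) (ℕ.≤-reflexive (sym (ℕ.+-suc ∣ p ∣ ∣ q ∣)))
∣p∪q∣≤∣p∣+∣q∣ (inside  ∷ p) (outside ∷ q) = s≤s (∣p∪q∣≤∣p∣+∣q∣ p q)
∣p∪q∣≤∣p∣+∣q∣ (inside  ∷ p) (inside  ∷ q) = s≤s (≤-trans (∣p∪q∣≤∣p∣+∣q∣ p q) (ℕ.+-monoʳ-≤ ∣ p ∣ (ℕ.n≤1+n ∣ q ∣)))

∣p-x∪⁅y⁆∣≤∣p∣ : ∀ {p : Subset n} {x} y → x ∈ p → ∣ (p - x) ∪ ⁅ y ⁆ ∣ ≤ ∣ p ∣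
∣p-x∪⁅y⁆∣≤∣p∣ {p = p} {x} y x∈p = begin
  ∣ (p - x) ∪ ⁅ y ⁆ ∣   ≤⟨ ∣p∪q∣≤∣p∣+∣q∣ (p - x) ⁅ y ⁆ ⟩
  ∣ p - x ∣ + ∣ ⁅ y ⁆ ∣ ≡⟨ cong (∣ p - x ∣ +_) (∣⁅x⁆∣≡1 y) ⟩
  ∣ p - x ∣ + 1         ≡⟨ ℕ.+-comm ∣ p - x ∣ 1 ⟩
  suc ∣ p - x ∣         ≤⟨ x∈p⇒∣p-x∣<∣p∣ x∈p ⟩
  ∣ p ∣                 ∎
  where open ℕ.≤-Reasoning

module _ {ℓ} {_<_ : Rel (Fin n) ℓ} (<-isSTO : IsStrictTotalOrder _≡_ _<_) where
  open IsStrictTotalOrder <-isSTO using (isStrictPartialOrder; compare; _<?_)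

  IsMinimum : ∀ {ℓ′} → Pred (Fin n) ℓ′ → Fin n → Set _
  IsMinimum P m = P m × (∀ y → P y → y ≢ m → m < y)

  minimum : ∀ {ℓ′} {P : Pred (Fin n) ℓ′} → Decidable P → ∀ {x} → P x → ∃ (IsMinimum P)
  minimum {P = P} P? {x} = go (spo-wellFounded isStrictPartialOrder x)
    where
    go : ∀ {x} → Acc _<_ x → P x → ∃ (IsMinimum P)
    go {x} (acc rs) Px with any? (λ y → P? y ×-dec y <? x)
    ... | yes (y , Py , y<x) = go (rs y<x) Py
    ... | no ∄smaller = x , Px , x-minimum
      where
      x-minimum : ∀ y → P y → y ≢ x → x < y
      x-minimum y Py y≢x with compare x y
      ... | tri< x<y _ _ = x<y
      ... | tri≈ _ x≡y _ = contradiction (sym x≡y) y≢x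
      ... | tri> _ _ y<x = contradiction (y , Py , y<x) ∄smaller

module MatroidProperties {n : ℕ} (M : Matroid n) where
  open Matroid M

  private
    variable
      A B C C₁ C₂ : Subset n
      a b e f : Fin n

  -- For independent A this says that x lies in the closure of A.
  Spans : Subset n → Fin n → Set
  Spans A x = x ∉ A → ¬ Independent M (A ∪ ⁅ x ⁆)

  IsBasis : Subset n → Set
  IsBasis B = Independent M B × (∀ x → Spans B x)

  ∈⇒spans : x ∈ A → Spans A x
  ∈⇒spans x∈A x∉A = contradiction x∈A x∉A

  independent-⊆ : A ⊆ B → Independent M B → Independent M A
  independent-⊆ A⊆B B-ind C c C⊆A = B-ind C c (⊆-trans C⊆A A⊆B)

  circuit⊆A∪⁅x⁆⇒x∈C : Independent M A → IsCircuit C → C ⊆ A ∪ ⁅ x ⁆ → x ∈ C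
  circuit⊆A∪⁅x⁆⇒x∈C {C = C} {x = x} A-ind c C⊆A∪⁅x⁆ with x ∈? C
  ... | yes x∈C = x∈C
  ... | no x∉C = ⊥-elim (A-ind C c (p⊆q∪⁅x⁆∧x∉p⇒p⊆q C⊆A∪⁅x⁆ x∉C))

  strong-circuit-elim : IsCircuit C₁ → IsCircuit C₂ → e ∈ C₁ → e ∈ C₂ → f ∈ C₁ → f ∉ C₂ →
                        ∃ λ C₃ → IsCircuit C₃ × C₃ ⊆ (C₁ ∪ C₂) - e × f ∈ C₃
  strong-circuit-elim = go (⊂-wellFounded _)
    where
    go : ∀ {C₁ C₂ e f} → Acc _⊂_ (C₁ ∪ C₂) →
         IsCircuit C₁ → IsCircuit C₂ → e ∈ C₁ → e ∈ C₂ → f ∈ C₁ → f ∉ C₂ →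
         ∃ λ C₃ → IsCircuit C₃ × C₃ ⊆ (C₁ ∪ C₂) - e × f ∈ C₃
    go {C₁} {C₂} {e} {f} (acc rs) c₁ c₂ e∈C₁ e∈C₂ f∈C₁ f∉C₂
      with circuit-elim C₁ C₂ e c₁ c₂ (λ { refl → f∉C₂ f∈C₁ }) e∈C₁ e∈C₂
    ... | C₃ , c₃ , C₃⊆ with f ∈? C₃
    ...   | yes f∈C₃ = C₃ , c₃ , C₃⊆ , f∈C₃
    ...   | no f∉C₃ with C₃ ⊆? C₁
    ...     | yes C₃⊆C₁ = ⊥-elim (x∈p-y⇒x≢y (C₃⊆ e∈C₃) refl)
      where
      e∈C₃ : e ∈ C₃
      e∈C₃ = subst (e ∈_) (sym (circuit-incomparable C₃ C₁ c₃ c₁ C₃⊆C₁)) e∈C₁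
    ...     | no C₃⊈C₁ with p⊈q⇒∃ C₃⊈C₁
    ...       | g , g∈C₃ , g∉C₁ =
      let C₄ , c₄ , C₄⊆ , e∈C₄ = go (rs C₂∪C₃⊂C₁∪C₂) c₂ c₃ g∈C₂ g∈C₃ e∈C₂ e∉C₃
          C₅ , c₅ , C₅⊆ , f∈C₅ = go (rs (C₁∪C₄⊂C₁∪C₂ C₄⊆)) c₁ c₄ e∈C₁ e∈C₄ f∈C₁ (f∉C₄ C₄⊆)
      in C₅ , c₅ , (λ x∈C₅ → -‿monoˡ (proj₁ (C₁∪C₄⊂C₁∪C₂ C₄⊆)) (C₅⊆ x∈C₅)) , f∈C₅
      where
      g∈C₁∪C₂ : g ∈ C₁ ∪ C₂
      g∈C₁∪C₂ = p-x⊆p (C₃⊆ g∈C₃)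
      g∈C₂ : g ∈ C₂
      g∈C₂ = x∈p∪q∧x∉p⇒x∈q g∈C₁∪C₂ g∉C₁
      e∉C₃ : e ∉ C₃
      e∉C₃ e∈C₃ = x∈p-y⇒x≢y (C₃⊆ e∈C₃) refl
      f∉C₂∪C₃ : f ∉ C₂ ∪ C₃
      f∉C₂∪C₃ = x∉p∪q f∉C₂ f∉C₃
      C₂∪C₃⊂C₁∪C₂ : C₂ ∪ C₃ ⊂ C₁ ∪ C₂
      C₂∪C₃⊂C₁∪C₂ = ∪-⊆ (q⊆p∪q C₁ C₂) (⊆-trans C₃⊆ p-x⊆p) , f , p⊆p∪q C₂ f∈C₁ , f∉C₂∪C₃
      module _ {C₄} (C₄⊆ : C₄ ⊆ (C₂ ∪ C₃) - g) where
        f∉C₄ : f ∉ C₄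
        f∉C₄ f∈C₄ = f∉C₂∪C₃ (p-x⊆p (C₄⊆ f∈C₄))
        C₁∪C₄⊂C₁∪C₂ : C₁ ∪ C₄ ⊂ C₁ ∪ C₂
        C₁∪C₄⊂C₁∪C₂ =
          ∪-⊆ (p⊆p∪q C₂) (⊆-trans (⊆-trans C₄⊆ p-x⊆p) (proj₁ C₂∪C₃⊂C₁∪C₂)) ,
          g , g∈C₁∪C₂ , x∉p∪q g∉C₁ (λ g∈C₄ → x∈p-y⇒x≢y (C₄⊆ g∈C₄) refl)

  -- An element x ∈ C outside A ∪ {e} lies in a circuit D ⊆ A ∪ {x}; strong elimination of x
  -- between C and D keeps e and shrinks C ─ A.
  spans-circuit : IsCircuit C → e ∈ C → (∀ {x} → x ∈ C → x ≢ e → Spans A x) → Spans A e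
  spans-circuit = go (⊂-wellFounded _)
    where
    go : ∀ {A C e} → Acc _⊂_ (C ─ A) →
         IsCircuit C → e ∈ C → (∀ {x} → x ∈ C → x ≢ e → Spans A x) → Spans A e
    go {A} {C} {e} (acc rs) c e∈C C-spanned e∉A A∪e-ind with C ⊆? A ∪ ⁅ e ⁆
    ... | yes C⊆A∪e = A∪e-ind C c C⊆A∪e
    ... | no C⊈A∪e with p⊈q⇒∃ C⊈A∪e
    ...   | x , x∈C , x∉A∪e = C-spanned x∈C x≢e x∉A A∪x-ind
      where
      x∉A : x ∉ A
      x∉A x∈A = x∉A∪e (p⊆p∪q ⁅ e ⁆ x∈A)
      x≢e : x ≢ e
      x≢e refl = x∉A∪e (q⊆p∪q A ⁅ e ⁆ (x∈⁅x⁆ e))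
      A∪x-ind : Independent M (A ∪ ⁅ x ⁆)
      A∪x-ind D d D⊆A∪x =
        let C′ , c′ , C′⊆ , e∈C′ = strong-circuit-elim c d x∈C x∈D e∈C e∉D
        in go (rs (C′─A⊂C─A C′⊆)) c′ e∈C′ (C′-spanned C′⊆) e∉A A∪e-ind
        where
        x∈D : x ∈ D
        x∈D = circuit⊆A∪⁅x⁆⇒x∈C (independent-⊆ (p⊆p∪q ⁅ e ⁆) A∪e-ind) d D⊆A∪x
        e∉D : e ∉ D
        e∉D e∈D with x∈p∪⁅y⁆⁻ (D⊆A∪x e∈D)
        ... | inj₁ e∈A = e∉A e∈A
        ... | inj₂ refl = x≢e refl
        module _ {C′} (C′⊆ : C′ ⊆ (C ∪ D) - x) where
          C′⊆C∪A : y ∈ C′ → y ∈ C ⊎ y ∈ A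
          C′⊆C∪A y∈C′ with x∈p∪q⁻ C D (p-x⊆p (C′⊆ y∈C′))
          ... | inj₁ y∈C = inj₁ y∈C
          ... | inj₂ y∈D = inj₂ (x∈p∪⁅y⁆∧x≢y⇒x∈p (D⊆A∪x y∈D) (x∈p-y⇒x≢y (C′⊆ y∈C′)))
          C′-spanned : ∀ {y} → y ∈ C′ → y ≢ e → Spans A y
          C′-spanned y∈C′ y≢e with C′⊆C∪A y∈C′
          ... | inj₁ y∈C = C-spanned y∈C y≢e
          ... | inj₂ y∈A = ∈⇒spans y∈A
          C′─A⊂C─A : C′ ─ A ⊂ C ─ A
          C′─A⊂C─A = C′─A⊆C─A , x , x∈p∧x∉q⇒x∈p─q x∈C x∉A ,
                     λ x∈C′─A → x∈p-y⇒x≢y (C′⊆ (p─q⊆p C′ A x∈C′─A)) refl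
            where
            C′─A⊆C─A : C′ ─ A ⊆ C ─ A
            C′─A⊆C─A y∈C′─A with C′⊆C∪A (p─q⊆p C′ A y∈C′─A)
            ... | inj₁ y∈C = x∈p∧x∉q⇒x∈p─q y∈C (x∈p─q⇒x∉q y∈C′─A)
            ... | inj₂ y∈A = contradiction y∈A (x∈p─q⇒x∉q y∈C′─A)

  spans-trans : Independent M B → (∀ {x} → x ∈ B → Spans A x) → Spans B y → Spans A y
  spans-trans {B = B} {A = A} {y = y} B-ind B-spanned B-spans-y y∉A A∪y-ind with y ∈? B
  ... | yes y∈B = B-spanned y∈B y∉A A∪y-ind
  ... | no y∉B = B-spans-y y∉B B∪y-ind
    where
    B∪y-ind : Independent M (B ∪ ⁅ y ⁆)
    B∪y-ind D d D⊆B∪y = spans-circuit d y∈D D-spanned y∉A A∪y-ind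
      where
      y∈D : y ∈ D
      y∈D = circuit⊆A∪⁅x⁆⇒x∈C B-ind d D⊆B∪y
      D-spanned : ∀ {x} → x ∈ D → x ≢ y → Spans A x
      D-spanned x∈D x≢y = B-spanned (x∈p∪⁅y⁆∧x≢y⇒x∈p (D⊆B∪y x∈D) x≢y)

  basis-exchange : IsBasis B → IsCircuit C → C ⊆ B ∪ ⁅ b ⁆ → a ∈ C → a ∈ B →
                   IsBasis ((B - a) ∪ ⁅ b ⁆)
  basis-exchange {B = B} {C = C} {b = b} {a = a} (B-ind , B-spans) c C⊆B∪b a∈C a∈B =
    B′-ind , λ x → spans-trans B-ind B′-spans-B (B-spans x)
    where
    C-a⊆B′ : ∀ {x} → x ∈ C → x ≢ a → x ∈ (B - a) ∪ ⁅ b ⁆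
    C-a⊆B′ x∈C x≢a with x∈p∪⁅y⁆⁻ (C⊆B∪b x∈C)
    ... | inj₁ x∈B = p⊆p∪q ⁅ b ⁆ (x∈p∧x≢y⇒x∈p-y x∈B x≢a)
    ... | inj₂ refl = q⊆p∪q (B - a) ⁅ b ⁆ (x∈⁅x⁆ b)
    B-a∪a⊆B : (B - a) ∪ ⁅ a ⁆ ⊆ B
    B-a∪a⊆B = ∪-⊆ p-x⊆p λ x∈⁅a⁆ → subst (_∈ B) (sym (x∈⁅y⁆⇒x≡y a x∈⁅a⁆)) a∈B
    B′-ind : Independent M ((B - a) ∪ ⁅ b ⁆)
    B′-ind D d D⊆B′ =
      spans-circuit c a∈C C-spanned (λ a∈B-a → x∈p-y⇒x≢y a∈B-a refl) (independent-⊆ B-a∪a⊆B B-ind)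
      where
      C-spanned : ∀ {x} → x ∈ C → x ≢ a → Spans (B - a) x
      C-spanned x∈C x≢a with x∈p∪⁅y⁆⁻ (C-a⊆B′ x∈C x≢a)
      ... | inj₁ x∈B-a = ∈⇒spans x∈B-a
      ... | inj₂ refl = λ _ B-a∪b-ind → B-a∪b-ind D d D⊆B′
    B′-spans-B : ∀ {x} → x ∈ B → Spans ((B - a) ∪ ⁅ b ⁆) x
    B′-spans-B {x} x∈B with x ≟ᶠ a
    ... | yes refl = spans-circuit c a∈C λ y∈C y≢a → ∈⇒spans (C-a⊆B′ y∈C y≢a)
    ... | no x≢a = ∈⇒spans (p⊆p∪q ⁅ b ⁆ (x∈p∧x≢y⇒x∈p-y x∈B x≢a))

  basis-maximal : IsBasis B → Independent M A → ∣ A ∣ ≤ ∣ B ∣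
  basis-maximal = go (⊂-wellFounded _)
    where
    go : ∀ {A B} → Acc _⊂_ (A ─ B) → IsBasis B → Independent M A → ∣ A ∣ ≤ ∣ B ∣
    go {A} {B} (acc rs) B-basis@(B-ind , B-spans) A-ind with A ⊆? B
    ... | yes A⊆B = p⊆q⇒∣p∣≤∣q∣ A⊆B
    ... | no A⊈B with p⊈q⇒∃ A⊈B
    ...   | b , b∈A , b∉B = decidable-stable (∣ A ∣ ≤? ∣ B ∣) λ ∣A∣≰∣B∣ → B-spans b b∉B (B∪b-ind ∣A∣≰∣B∣)
      where
      -- Exchanging some a ∈ B ∖ A for b gives a basis no larger than B, closer to A.
      B∪b-ind : ¬ ∣ A ∣ ≤ ∣ B ∣ → Independent M (B ∪ ⁅ b ⁆)
      B∪b-ind ∣A∣≰∣B∣ C c C⊆B∪b with p⊈q⇒∃ (A-ind C c)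
      ... | a , a∈C , a∉A =
        ∣A∣≰∣B∣ (≤-trans (go (rs A─B′⊂A─B) (basis-exchange B-basis c C⊆B∪b a∈C a∈B) A-ind)
                         (∣p-x∪⁅y⁆∣≤∣p∣ b a∈B))
        where
        a∈B : a ∈ B
        a∈B = x∈p∪⁅y⁆∧x≢y⇒x∈p (C⊆B∪b a∈C) λ { refl → a∉A b∈A }
        A─B′⊆A─B : A ─ ((B - a) ∪ ⁅ b ⁆) ⊆ A ─ B
        A─B′⊆A─B {y} y∈A─B′ with y ∈? B | y ≟ᶠ a
        ... | no y∉B | _ = x∈p∧x∉q⇒x∈p─q (p─q⊆p A _ y∈A─B′) y∉B
        ... | yes _ | yes refl = contradiction (p─q⊆p A _ y∈A─B′) a∉A
        ... | yes y∈B | no y≢a =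
          contradiction (p⊆p∪q ⁅ b ⁆ (x∈p∧x≢y⇒x∈p-y y∈B y≢a)) (x∈p─q⇒x∉q y∈A─B′)
        A─B′⊂A─B : A ─ ((B - a) ∪ ⁅ b ⁆) ⊂ A ─ B
        A─B′⊂A─B = A─B′⊆A─B , b , x∈p∧x∉q⇒x∈p─q b∈A b∉B ,
                   λ b∈A─B′ → x∈p─q⇒x∉q b∈A─B′ (q⊆p∪q (B - a) ⁅ b ⁆ (x∈⁅x⁆ b))

module _ {n : ℕ} {w : Fin n → ℚ} (w-inj : Injective _≡_ _≡_ w) where

  <w-isStrictTotalOrder : IsStrictTotalOrder _≡_ (_<w_ w)
  <w-isStrictTotalOrder = record
    { isStrictPartialOrder = record
      { isEquivalence = isEquivalence
      ; irrefl = λ { refl → ℚ.<-irrefl refl }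
      ; trans = ℚ.<-trans
      ; <-resp-≈ = resp₂ (_<w_ w)
      }
    ; compare = compare
    }
    where
    compare : Trichotomous _≡_ (_<w_ w)
    compare x y with ℚ.<-cmp (w x) (w y)
    ... | tri< wx<wy wx≢wy wx≯wy = tri< wx<wy (wx≢wy ∘ cong w) wx≯wy
    ... | tri≈ wx≮wy wx≡wy wx≯wy = tri≈ wx≮wy (w-inj wx≡wy) wx≯wy
    ... | tri> wx≮wy wx≢wy wx>wy = tri> wx≮wy (wx≢wy ∘ cong w) wx>wy

  IsB-exists : ∀ I {C} → Nonempty C → ∃ (IsB w I C)
  IsB-exists I {C} (x , x∈C) with C ⊆? I
  ... | yes C⊆I =
    let m , C-min = minimum <w-isStrictTotalOrder (_∈? C) x∈C
    in C - m , inj₁ (C⊆I , m , C-min , refl)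
  ... | no C⊈I =
    let y , y∈C , y∉I = p⊈q⇒∃ C⊈I
        m , C─I-max = minimum (Flip.isStrictTotalOrder <w-isStrictTotalOrder) (_∈? C ─ I)
                              (x∈p∧x∉q⇒x∈p─q y∈C y∉I)
    in (C ∩ I) ∪ ⁅ m ⁆ , inj₂ (C⊈I , m , C─I-max , refl)

module _ {n : ℕ} (w : Fin n → ℚ) (I : Subset n) where

  data _≺_ (x y : Fin n) : Set where
    outside≺inside : x ∉ I → y ∈ I → x ≺ y
    weight≺ : (x ∈ I → y ∈ I) → _<w_ w x y → x ≺ y

  ≺-isStrictPartialOrder : IsStrictPartialOrder _≡_ _≺_
  ≺-isStrictPartialOrder = record
    { isEquivalence = isEquivalence
    ; irrefl = irrefl
    ; trans = trans
    ; <-resp-≈ = resp₂ _≺_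
    }
    where
    irrefl : ∀ {x y} → x ≡ y → ¬ x ≺ y
    irrefl refl (outside≺inside x∉I x∈I) = x∉I x∈I
    irrefl refl (weight≺ _ wx<wx) = ℚ.<-irrefl refl wx<wx
    trans : ∀ {x y z} → x ≺ y → y ≺ z → x ≺ z
    trans (outside≺inside _ y∈I) (outside≺inside y∉I _) = contradiction y∈I y∉I
    trans (outside≺inside x∉I y∈I) (weight≺ y→z _) = outside≺inside x∉I (y→z y∈I)
    trans (weight≺ x→y _) (outside≺inside y∉I z∈I) = outside≺inside (y∉I ∘ x→y) z∈I
    trans (weight≺ x→y wx<wy) (weight≺ y→z wy<wz) = weight≺ (y→z ∘ x→y) (ℚ.<-trans wx<wy wy<wz)

  IsB⇒⊆ : ∀ {C B} → IsB w I C B → B ⊆ C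
  IsB⇒⊆ (inj₁ (_ , _ , _ , refl)) = p-x⊆p
  IsB⇒⊆ {C} (inj₂ (_ , m , (m∈C─I , _) , refl)) =
    ∪-⊆ (p∩q⊆p C I) λ x∈⁅m⁆ → subst (_∈ C) (sym (x∈⁅y⁆⇒x≡y m x∈⁅m⁆)) (p─q⊆p C I m∈C─I)

  IsB⇒≺ : ∀ {C B x y} → IsB w I C B → x ∈ C → x ∉ B → y ∈ B → x ≺ y
  IsB⇒≺ {C} {x = x} {y} (inj₁ (C⊆I , m , (_ , m-min) , refl)) x∈C x∉C-m y∈C-m with x ≟ᶠ m
  ... | yes refl = weight≺ (λ _ → C⊆I (p-x⊆p y∈C-m)) (m-min y (p-x⊆p y∈C-m) (x∈p-y⇒x≢y y∈C-m))
  ... | no x≢m = contradiction (x∈p∧x≢y⇒x∈p-y x∈C x≢m) x∉C-m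
  IsB⇒≺ {C} {x = x} (inj₂ (_ , m , (_ , m-max) , refl)) x∈C x∉B y∈B = case x∈p∪⁅y⁆⁻ y∈B of λ where
      (inj₁ y∈C∩I) → outside≺inside x∉I (proj₂ (x∈p∩q⁻ C I y∈C∩I))
      (inj₂ refl) → weight≺ (λ x∈I → contradiction x∈I x∉I) (m-max x (x∈p∧x∉q⇒x∈p─q x∈C x∉I) x≢m)
    where
    x∉I : x ∉ I
    x∉I x∈I = x∉B (p⊆p∪q ⁅ m ⁆ (x∈p∩q⁺ (x∈C , x∈I)))
    x≢m : x ≢ m
    x≢m refl = x∉B (q⊆p∪q (C ∩ I) ⁅ x ⁆ (x∈⁅x⁆ x))

module _ {n : ℕ} {w : Fin n → ℚ} (w-inj : Injective _≡_ _≡_ w) (M : Matroid n) (I : Subset n) where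
  open Matroid M
  open MatroidProperties M

  face⇒independent : ∀ {τ} → IsFace w M I τ → Independent M τ
  face⇒independent face C c C⊆τ =
    let B , C-B = IsB-exists w-inj I (decidable-stable (nonempty? C) (circuit-nonempty C c))
    in face C B c C-B (⊆-trans (IsB⇒⊆ w I C-B) C⊆τ)

  facet⇒basis : ∀ {τ} → IsFacet w M I τ → IsBasis τ
  facet⇒basis {τ} (face , maximal) =
    face⇒independent face , All.wfRec (spo-wellFounded (≺-isStrictPartialOrder w I)) _ (Spans τ) spans
    where
    spans : ∀ x → (∀ {y} → _≺_ w I y x → Spans τ y) → Spans τ x
    spans x ≺x-spanned x∉τ τ∪x-ind = x∉τ (subst (x ∈_) τ∪x≡τ (q⊆p∪q τ ⁅ x ⁆ (x∈⁅x⁆ x)))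
      where
      τ∪x-face : IsFace w M I (τ ∪ ⁅ x ⁆)
      τ∪x-face C B c C-B B⊆τ∪x with x ∈? B
      ... | no x∉B = face C B c C-B (p⊆q∪⁅x⁆∧x∉p⇒p⊆q B⊆τ∪x x∉B)
      ... | yes x∈B = spans-circuit c (IsB⇒⊆ w I C-B x∈B) C-spanned x∉τ τ∪x-ind
        where
        C-spanned : ∀ {y} → y ∈ C → y ≢ x → Spans τ y
        C-spanned {y} y∈C y≢x with y ∈? B
        ... | yes y∈B = ∈⇒spans (x∈p∪⁅y⁆∧x≢y⇒x∈p (B⊆τ∪x y∈B) y≢x)
        ... | no y∉B = ≺x-spanned (IsB⇒≺ w I C-B y∈C y∉B x∈B)
      τ∪x≡τ : τ ∪ ⁅ x ⁆ ≡ τ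
      τ∪x≡τ = maximal (τ ∪ ⁅ x ⁆) τ∪x-face (p⊆p∪q ⁅ x ⁆)

corollary3p3 : (n d : ℕ) (M : Matroid n) → HasRank M d →
    (I : Subset n) → (∀ i → i ∈ I → ¬ IsLoop M i) →
    (w : Fin n → ℚ) → Injective _≡_ _≡_ w →
    PureOfDim-1 w M I d
corollary3p3 n d M ((B , B-ind , ∣B∣≡d) , rank-bound) I _ w w-inj τ τ-facet =
  ≤-antisym (rank-bound τ (proj₁ τ-basis))
            (subst (_≤ ∣ τ ∣) ∣B∣≡d (MatroidProperties.basis-maximal M τ-basis B-ind))
  where
  τ-basis : MatroidProperties.IsBasis M τ
  τ-basis = facet⇒basis w-inj M I τ-facet
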